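{- Let $\pi:\mathbb{N}\to\mathbb{N}$ be a permutation of the positive integers. Then $\pi$ belongs to the Lévy group $\mathcal{G}$ if and only if the sequence $\left(\frac{\pi(n)}{n}\right)_{n\ge 1}$ converges statistically to $1$.
   Context: $\mathbb{N}=\{1,2,3,\dots\}$. For $A\subseteq\mathbb{N}$ let $A(n)=|A\cap[1,n]|$; the asymptotic density of $A$ is $d(A)=\lim_{n\to\infty}A(n)/n$ when this limit exists. The Lévy group $\mathcal{G}$ is the group of all permutations $\pi$ of $\mathbb{N}$ such that $\lim_{n\to\infty}\frac{|\{k:\ k\le n<\pi(k)\}|}{n}=0$. A real sequence $(x_n)$ converges statistically to $L$ if for every $\varepsilon>0$ the set $\{n:\ |x_n-L|\ge\varepsilon\}$ has asymptotic density $0$. -}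

module Defs where

open import Data.Nat as ℕ using (ℕ; zero; suc; NonZero; _≤_)
open import Data.Integer using (+_)
open import Data.Rational using (ℚ; 0ℚ; 1ℚ; _/_; _-_; ∣_∣; _<_; Positive)
open import Data.Rational.Properties using (_≤?_)
import Data.Nat.Properties as ℕP
open import Data.Product using (Σ; ∃-syntax; proj₁; _,_)
open import Data.Bool using (Bool; if_then_else_)
open import Relation.Nullary using (does)
open import Relation.Unary using (Pred; Decidable)
open import Function.Bundles using (_↔_; Inverse)
open import Level using (0ℓ)

ℕ⁺ : Set
ℕ⁺ = Σ ℕ NonZero

Perm⁺ : Set
Perm⁺ = ℕ⁺ ↔ ℕ⁺

app : Perm⁺ → ℕ → ℕ
app π zero = zero            -- junk value, never used (0 ∉ ℕ⁺)
app π (suc i) = proj₁ (Inverse.to π (suc i , _))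

-- a / b as a rational, with the (unused) convention a / 0 = 0
frac : ℕ → ℕ → ℚ
frac a zero = 0ℚ
frac a (suc d) = (+ a) / suc d

-- A(n) = |A ∩ [1,n]| for a decidable A ⊆ ℕ (only positive members counted)
countUpTo : (A : Pred ℕ 0ℓ) → Decidable A → ℕ → ℕ
countUpTo A A? zero = zero
countUpTo A A? (suc n) =
  (if does (A? (suc n)) then suc else (λ x → x)) (countUpTo A A? n)

ConvergesTo : (ℕ → ℚ) → ℚ → Set
ConvergesTo x L =
  (ε : ℚ) → Positive ε → ∃[ N ] ((n : ℕ) → N ≤ n → 1 ≤ n → ∣ x n - L ∣ < ε)

HasDensity : (A : Pred ℕ 0ℓ) → Decidable A → ℚ → Set
HasDensity A A? d = ConvergesTo (λ n → frac (countUpTo A A? n) n) d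

StatConvergesTo : (ℕ → ℚ) → ℚ → Set
StatConvergesTo x L =
  (ε : ℚ) → Positive ε →
  HasDensity (λ n → ε Data.Rational.≤ ∣ x n - L ∣) (λ n → ε ≤? ∣ x n - L ∣) 0ℚ

escapeCount : Perm⁺ → ℕ → ℕ
escapeCount π n = countUpTo (λ k → n ℕ.< app π k) (λ k → n ℕP.<? app π k) n

InLevyGroup : Perm⁺ → Set
InLevyGroup π = ConvergesTo (λ n → frac (escapeCount π n) n) 0ℚ

{-# OPTIONS --safe #-}
module Submission where

-- Write e(n) = #{k ≤ n : π k > n}, so that π ∈ 𝒢 means e(n) = o(n), and fix θ = q/(p + q) < 1.
-- Every k ∈ (θn, n] with π k ≥ k/θ escapes past n, and every k ∈ (θn, n] with π k ≤ θk is sent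
-- into [1, θn], which by injectivity happens at most e(θn) times. Hence the numbers U(n), V(n) of
-- such k ≤ n satisfy U(n) ≤ U(⌊θn⌋) + e(n) and V(n) ≤ V(⌊θn⌋) + e(⌊θn⌋), and summing along the
-- geometric sequence n, θn, θ²n, … gives U(n), V(n) = o(n), i.e. π(n)/n → 1 statistically.
-- Conversely, an index k ≤ n escaping past n has π k ≥ (1 + 1/Q) k unless k > Qn/(Q + 1),
-- so e(n) is o(n) plus at most about n/(Q + 1), for every Q.

open import Defs
open import Data.Nat
open import Data.Nat.Properties
open import Data.Nat.DivMod using (_/_; _%_; m/n*n≤m; m≡m%n+[m/n]*n; m%n<n)
open import Data.Nat.Induction using (<-rec)
open import Data.Nat.Tactic.RingSolver using (solve-∀)
open import Data.Nat.Coprimality using (Coprime; 1-coprimeTo)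
open import Data.Integer as ℤ using (+_; +[1+_]; _⊖_)
import Data.Integer.Properties as ℤ
open import Data.Rational as ℚ using (ℚ; mkℚ; toℚᵘ; 0ℚ; 1ℚ)
import Data.Rational.Properties as ℚ
open import Data.Rational.Unnormalised as ℚᵘ using (mkℚᵘ; *≡*; *<*; *≤*) renaming (_≃_ to _≃ᵘ_)
import Data.Rational.Unnormalised.Properties as ℚᵘ
open import Data.Product using (_×_; _,_; proj₁; proj₂; ∃-syntax)
open import Data.Sum using (_⊎_; inj₁; inj₂; map₁)
open import Function using (_∘_; flip)
open import Function.Bundles using (_⇔_; mk⇔; Equivalence; Inverse; Injection)
open import Function.Properties.Inverse using (↔⇒↣)
open import Level using (0ℓ)
open import Relation.Binary.PropositionalEquality
open import Relation.Nullary using (¬_; Dec; yes; no; contradiction)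
open import Relation.Nullary.Decidable using (_×-dec_)
open import Relation.Unary using (Pred; Decidable)

private variable
  A B C : Pred ℕ 0ℓ
  n : ℕ

count : Decidable A → ℕ → ℕ
count {A} = countUpTo A

count-suc-yes : (A? : Decidable A) → A (suc n) → count A? (suc n) ≡ suc (count A? n)
count-suc-yes {n = n} A? a with A? (suc n)
... | yes _ = refl
... | no ¬a = contradiction a ¬a

count-suc-no : (A? : Decidable A) → ¬ A (suc n) → count A? (suc n) ≡ count A? n
count-suc-no {n = n} A? ¬a with A? (suc n)
... | yes a = contradiction a ¬a
... | no _ = refl

count-≤-suc : (A? : Decidable A) → ∀ n → count A? n ≤ count A? (suc n)
count-≤-suc A? n with A? (suc n)
... | yes _ = n≤1+n _
... | no _ = ≤-refl

count-≤ : (A? : Decidable A) → ∀ n → count A? n ≤ n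
count-≤ A? zero = z≤n
count-≤ A? (suc n) with A? (suc n)
... | yes _ = s≤s (count-≤ A? n)
... | no _ = m≤n⇒m≤1+n (count-≤ A? n)

All≤ : ℕ → Pred ℕ 0ℓ → Set
All≤ n P = ∀ k → 1 ≤ k → k ≤ n → P k

All≤-last : ∀ {P} → All≤ (suc n) P → P (suc n)
All≤-last all = all _ (s≤s z≤n) ≤-refl

All≤-init : ∀ {P} → All≤ (suc n) P → All≤ n P
All≤-init all k k≥1 k≤n = all k k≥1 (m≤n⇒m≤1+n k≤n)

count-zero : (A? : Decidable A) → ∀ n → All≤ n (λ k → ¬ A k) → count A? n ≡ 0
count-zero A? zero none = refl
count-zero A? (suc n) none = begin
  count A? (suc n) ≡⟨ count-suc-no A? (All≤-last none) ⟩
  count A? n       ≡⟨ count-zero A? n (All≤-init none) ⟩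
  0                ∎
  where open ≡-Reasoning

count-mono : (A? : Decidable A) (B? : Decidable B) → ∀ n →
  All≤ n (λ k → A k → B k) → count A? n ≤ count B? n
count-mono A? B? zero A⇒B = z≤n
count-mono A? B? (suc n) A⇒B with A? (suc n)
... | yes a = begin
  suc (count A? n)  ≤⟨ s≤s (count-mono A? B? n (All≤-init A⇒B)) ⟩
  suc (count B? n)  ≡⟨ count-suc-yes B? (All≤-last A⇒B a) ⟨
  count B? (suc n)  ∎
  where open ≤-Reasoning
... | no _ = ≤-trans (count-mono A? B? n (All≤-init A⇒B)) (count-≤-suc B? n)

count-⊎ : (A? : Decidable A) (B? : Decidable B) (C? : Decidable C) → ∀ n →
  All≤ n (λ k → A k → B k ⊎ C k) → count A? n ≤ count B? n + count C? n
count-⊎ A? B? C? zero A⇒B∪C = z≤n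
count-⊎ A? B? C? (suc n) A⇒B∪C with A? (suc n) | count-⊎ A? B? C? n (All≤-init A⇒B∪C)
... | no _ | ih = ≤-trans ih (+-mono-≤ (count-≤-suc B? n) (count-≤-suc C? n))
... | yes a | ih with All≤-last A⇒B∪C a
...   | inj₁ b = begin
  suc (count A? n)                     ≤⟨ s≤s ih ⟩
  suc (count B? n + count C? n)        ≡⟨ cong (_+ count C? n) (count-suc-yes B? b) ⟨
  count B? (suc n) + count C? n        ≤⟨ +-monoʳ-≤ _ (count-≤-suc C? n) ⟩
  count B? (suc n) + count C? (suc n)  ∎
  where open ≤-Reasoning
...   | inj₂ c = begin
  suc (count A? n)                     ≤⟨ s≤s ih ⟩
  suc (count B? n + count C? n)        ≡⟨ +-suc _ _ ⟨
  count B? n + suc (count C? n)        ≡⟨ cong (_+_ (count B? n)) (count-suc-yes C? c) ⟨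
  count B? n + count C? (suc n)        ≤⟨ +-monoˡ-≤ _ (count-≤-suc B? n) ⟩
  count B? (suc n) + count C? (suc n)  ∎
  where open ≤-Reasoning

count-split : (A? : Decidable A) → ∀ {m n} → m ≤ n →
  count A? n ≡ count A? m + count (λ k → (m <? k) ×-dec A? k) n
count-split {A = A} A? {m} = split _
  where
  open ≡-Reasoning
  B? : Decidable (λ k → m < k × A k)
  B? k = (m <? k) ×-dec A? k
  split : ∀ n → m ≤ n → count A? n ≡ count A? m + count B? n
  split n m≤n with m≤n⇒m<n∨m≡n m≤n
  split n _ | inj₂ refl = sym (begin
    count A? m + count B? m  ≡⟨ cong (_+_ (count A? m))
                                (count-zero B? m (λ k _ k≤m (m<k , _) → <⇒≱ m<k k≤m)) ⟩
    count A? m + 0           ≡⟨ +-identityʳ _ ⟩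
    count A? m               ∎)
  split (suc n) _ | inj₁ (s≤s m≤n) = step (A? (suc n))
    where
    step : Dec (A (suc n)) → count A? (suc n) ≡ count A? m + count B? (suc n)
    step (yes a) = begin
      count A? (suc n)               ≡⟨ count-suc-yes A? a ⟩
      suc (count A? n)               ≡⟨ cong suc (split n m≤n) ⟩
      suc (count A? m + count B? n)  ≡⟨ +-suc _ _ ⟨
      count A? m + suc (count B? n)  ≡⟨ cong (_+_ (count A? m)) (count-suc-yes B? (s≤s m≤n , a)) ⟨
      count A? m + count B? (suc n)  ∎
    step (no ¬a) = begin
      count A? (suc n)               ≡⟨ count-suc-no A? ¬a ⟩
      count A? n                     ≡⟨ split n m≤n ⟩
      count A? m + count B? n        ≡⟨ cong (_+_ (count A? m)) (count-suc-no B? (¬a ∘ proj₂)) ⟨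
      count A? m + count B? (suc n)  ∎

count-complement : (A? : Decidable A) (B? : Decidable B) →
  (∀ k → A k ⊎ B k) → (∀ k → A k → ¬ B k) → ∀ n → count A? n + count B? n ≡ n
count-complement A? B? A∪B A∩B zero = refl
count-complement {A} {B} A? B? A∪B A∩B (suc n) = step (A∪B (suc n))
  where
  open ≡-Reasoning
  ih : count A? n + count B? n ≡ n
  ih = count-complement A? B? A∪B A∩B n
  step : A (suc n) ⊎ B (suc n) → count A? (suc n) + count B? (suc n) ≡ suc n
  step (inj₁ a) = begin
    count A? (suc n) + count B? (suc n)  ≡⟨ cong₂ _+_ (count-suc-yes A? a) (count-suc-no B? (A∩B _ a)) ⟩
    suc (count A? n + count B? n)        ≡⟨ cong suc ih ⟩
    suc n                                ∎
  step (inj₂ b) = begin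
    count A? (suc n) + count B? (suc n)  ≡⟨ cong₂ _+_ (count-suc-no A? (λ a → A∩B _ a b))
                                                       (count-suc-yes B? b) ⟩
    count A? n + suc (count B? n)        ≡⟨ +-suc _ _ ⟩
    suc (count A? n + count B? n)        ≡⟨ cong suc ih ⟩
    suc n                                ∎

count-≤1 : (A? : Decidable A) → (∀ {i j} → 1 ≤ i → 1 ≤ j → A i → A j → i ≡ j) →
  ∀ n → count A? n ≤ 1
count-≤1 A? unique zero = z≤n
count-≤1 A? unique (suc n) with A? (suc n)
... | yes a = s≤s (≤-reflexive (count-zero A? n
        (λ k k≥1 k≤n ak → <⇒≢ (s≤s k≤n) (unique k≥1 (s≤s z≤n) ak a))))
... | no _ = count-≤1 A? unique n

count-d<c*k : ∀ c d n → c * count (λ k → d <? c * k) n ≤ c * suc n ∸ d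
count-d<c*k c d zero = ≤-trans (≤-reflexive (*-zeroʳ c)) z≤n
count-d<c*k c d (suc n) = step (d <? c * suc n)
  where
  open ≤-Reasoning
  T? : Decidable (λ k → d < c * k)
  T? k = d <? c * k
  ih : c * count T? n ≤ c * suc n ∸ d
  ih = count-d<c*k c d n
  step : Dec (d < c * suc n) → c * count T? (suc n) ≤ c * suc (suc n) ∸ d
  step (yes d<c[1+n]) = begin
    c * count T? (suc n)   ≡⟨ cong (c *_) (count-suc-yes T? d<c[1+n]) ⟩
    c * suc (count T? n)   ≡⟨ *-suc c _ ⟩
    c + c * count T? n     ≤⟨ +-monoʳ-≤ c ih ⟩
    c + (c * suc n ∸ d)    ≡⟨ +-∸-assoc c (<⇒≤ d<c[1+n]) ⟨
    c + c * suc n ∸ d      ≡⟨ cong (_∸ d) (*-suc c (suc n)) ⟨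
    c * suc (suc n) ∸ d    ∎
  step (no d≮c[1+n]) = begin
    c * count T? (suc n)   ≡⟨ cong (c *_) (count-suc-no T? d≮c[1+n]) ⟩
    c * count T? n         ≤⟨ ih ⟩
    c * suc n ∸ d          ≤⟨ ∸-monoˡ-≤ d (*-monoʳ-≤ c (n≤1+n _)) ⟩
    c * suc (suc n) ∸ d    ∎

Negligible : (ℕ → ℕ) → Set
Negligible a = ∀ D → ∃[ N ] ∀ n → N < n → D * a n < n

negligible-mono : ∀ {a b} → (∀ n → a n ≤ b n) → Negligible b → Negligible a
negligible-mono a≤b neg-b D with neg-b D
... | N , b-small = N , λ n N<n → ≤-<-trans (*-monoʳ-≤ D (a≤b n)) (b-small n N<n)

negligible-+ : ∀ {a b} → Negligible a → Negligible b → Negligible (λ n → a n + b n)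
negligible-+ {a} {b} neg-a neg-b D with neg-a (2 * D) | neg-b (2 * D)
... | Na , a-small | Nb , b-small = Na ⊔ Nb , λ n N<n → *-cancelˡ-< 2 _ _ (begin-strict
  2 * (D * (a n + b n))        ≡⟨ distrib D (a n) (b n) ⟩
  2 * D * a n + 2 * D * b n    <⟨ +-mono-< (a-small n (m⊔n<o⇒m<o Na Nb N<n))
                                           (b-small n (m⊔n<o⇒n<o Na Nb N<n)) ⟩
  n + n                        ≡⟨ double n ⟩
  2 * n                        ∎)
  where
  open ≤-Reasoning
  distrib : ∀ D x y → 2 * (D * (x + y)) ≡ 2 * D * x + 2 * D * y
  distrib = solve-∀
  double : ∀ n → n + n ≡ 2 * n
  double = solve-∀

negligible-prefix : ∀ {a} → (∀ n → a n ≤ n) → Negligible a →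
  ∀ D → ∃[ N ] ∀ {n j} → N < n → j ≤ n → D * a j ≤ n
negligible-prefix {a} a≤id neg-a D with neg-a D
... | N , a-small = D * N , bound
  where
  bound : ∀ {n j} → D * N < n → j ≤ n → D * a j ≤ n
  bound {n} {j} DN<n j≤n with j ≤? N
  ... | yes j≤N = ≤-trans (*-monoʳ-≤ D (≤-trans (a≤id j) j≤N)) (<⇒≤ DN<n)
  ... | no j≰N = ≤-trans (<⇒≤ (a-small j (≰⇒> j≰N))) j≤n

IsFloorDiv : ℕ → ℕ → ℕ → Set
IsFloorDiv x b m = b * m ≤ x × x < b * suc m

floorDiv : ∀ x b .{{_ : NonZero b}} → IsFloorDiv x b (x / b)
floorDiv x b = ≤-trans (≤-reflexive (*-comm b (x / b))) (m/n*n≤m x b) , (begin-strict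
  x                     ≡⟨ m≡m%n+[m/n]*n x b ⟩
  x % b + x / b * b     <⟨ +-monoˡ-< _ (m%n<n x b) ⟩
  b + x / b * b         ≡⟨ *-comm (suc (x / b)) b ⟩
  b * suc (x / b)       ∎)
  where open ≤-Reasoning

private
  instance
    nonZero-+ : ∀ {m n} → .{{NonZero m}} → NonZero (m + n)
    nonZero-+ {suc m} = _

module _ (p q : ℕ) .{{_ : NonZero p}} where

  ratio-floor-≤ : ∀ {n m} → IsFloorDiv (q * n) (p + q) m → m ≤ n
  ratio-floor-≤ {n} {m} (lower , _) = *-cancelˡ-≤ (p + q) (begin
    (p + q) * m  ≤⟨ lower ⟩
    q * n        ≤⟨ *-monoˡ-≤ n (m≤n+m q p) ⟩
    (p + q) * n  ∎)
    where open ≤-Reasoning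

  ratio-floor-< : ∀ {n m} → 1 ≤ n → IsFloorDiv (q * n) (p + q) m → m < n
  ratio-floor-< {n} {m} n≥1 (lower , _) = *-cancelˡ-< (p + q) _ _ (begin-strict
    (p + q) * m  ≤⟨ lower ⟩
    q * n        <⟨ *-monoˡ-< n {{>-nonZero n≥1}} (m<n+m q (>-nonZero⁻¹ p)) ⟩
    (p + q) * n  ∎)
    where open ≤-Reasoning

  negligible-by-descent : ∀ {c g : ℕ → ℕ} → (∀ n → c n ≤ n) → (∀ n → g n ≤ n) → Negligible g →
    (∀ {n m} → IsFloorDiv (q * n) (p + q) m → ∃[ j ] j ≤ n × c n ≤ c m + g j) →
    Negligible c
  negligible-by-descent {c} {g} c≤id g≤id neg-g step E
    with negligible-prefix g≤id neg-g (2 * (p + q) * E)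
  ... | N , g-small = K , c-small
    where
    open ≤-Reasoning
    r D K : ℕ
    r = p + q
    D = 2 * r * E
    K = p * (D * N)

    -- Each step n ↦ ⌊q n/(p + q)⌋ adds at most n/D, and these increments sum to at most r n/(p D).
    invariant : ∀ n → p * (D * c n) ≤ r * n + K
    invariant = <-rec _ descend
      where
      descend : ∀ n → (∀ {m} → m < n → p * (D * c m) ≤ r * m + K) → p * (D * c n) ≤ r * n + K
      descend n below with n ≤? N
      ... | yes n≤N = begin
        p * (D * c n)  ≤⟨ *-monoʳ-≤ p (*-monoʳ-≤ D (≤-trans (c≤id n) n≤N)) ⟩
        K              ≤⟨ m≤n+m K (r * n) ⟩
        r * n + K      ∎
      ... | no n≰N with step (floorDiv (q * n) r)
      ...   | j , j≤n , c-step = begin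
        p * (D * c n)                  ≤⟨ *-monoʳ-≤ p (*-monoʳ-≤ D c-step) ⟩
        p * (D * (c m + g j))          ≡⟨ distrib p D (c m) (g j) ⟩
        p * (D * c m) + p * (D * g j)  ≤⟨ +-mono-≤ (below (ratio-floor-< n≥1 floor))
                                                   (*-monoʳ-≤ p (g-small (≰⇒> n≰N) j≤n)) ⟩
        r * m + K + p * n              ≤⟨ +-monoˡ-≤ (p * n) (+-monoˡ-≤ K (proj₁ floor)) ⟩
        q * n + K + p * n              ≡⟨ regroup p q n K ⟩
        r * n + K                      ∎
        where
        m : ℕ
        m = q * n / r
        floor : IsFloorDiv (q * n) r m
        floor = floorDiv (q * n) r
        n≥1 : 1 ≤ n
        n≥1 = ≤-trans (s≤s z≤n) (≰⇒> n≰N)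
        distrib : ∀ p D x y → p * (D * (x + y)) ≡ p * (D * x) + p * (D * y)
        distrib = solve-∀
        regroup : ∀ p q n K → q * n + K + p * n ≡ (p + q) * n + K
        regroup = solve-∀

    c-small : ∀ n → K < n → E * c n < n
    c-small n K<n = *-cancelˡ-< (2 * r) _ _ (begin-strict
      2 * r * (E * c n)  ≡⟨ *-assoc (2 * r) E (c n) ⟨
      D * c n            ≤⟨ m≤n*m (D * c n) p ⟩
      p * (D * c n)      ≤⟨ invariant n ⟩
      r * n + K          <⟨ +-monoʳ-< (r * n) K<n ⟩
      r * n + n          ≤⟨ +-monoʳ-≤ (r * n) (m≤n*m n r) ⟩
      r * n + r * n      ≡⟨ double r n ⟩
      2 * r * n          ∎)
      where
      double : ∀ r n → r * n + r * n ≡ 2 * r * n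
      double = solve-∀

≤∣-∣*⇒stretched⊎shrunk : ∀ p q k b → p * k ≤ ∣ b - k ∣ * q → (p + q) * k ≤ q * b ⊎ (p + q) * b ≤ q * k
≤∣-∣*⇒stretched⊎shrunk p q k b pk≤ with ≤-total k b
... | inj₁ k≤b = inj₁ (begin
  (p + q) * k            ≡⟨ *-distribʳ-+ k p q ⟩
  p * k + q * k          ≤⟨ +-monoˡ-≤ (q * k) pk≤ ⟩
  ∣ b - k ∣ * q + q * k  ≡⟨ cong (λ x → x * q + q * k) (m≤n⇒∣n-m∣≡n∸m k≤b) ⟩
  (b ∸ k) * q + q * k    ≡⟨ cong (_+ q * k) (*-comm (b ∸ k) q) ⟩
  q * (b ∸ k) + q * k    ≡⟨ *-distribˡ-+ q (b ∸ k) k ⟨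
  q * (b ∸ k + k)        ≡⟨ cong (q *_) (m∸n+n≡m k≤b) ⟩
  q * b                  ∎)
  where open ≤-Reasoning
... | inj₂ b≤k = inj₂ (begin
  (p + q) * b            ≡⟨ *-distribʳ-+ b p q ⟩
  p * b + q * b          ≤⟨ +-monoˡ-≤ (q * b) (*-monoʳ-≤ p b≤k) ⟩
  p * k + q * b          ≤⟨ +-monoˡ-≤ (q * b) pk≤ ⟩
  ∣ b - k ∣ * q + q * b  ≡⟨ cong (λ x → x * q + q * b) (m≤n⇒∣m-n∣≡n∸m b≤k) ⟩
  (k ∸ b) * q + q * b    ≡⟨ cong (_+ q * b) (*-comm (k ∸ b) q) ⟩
  q * (k ∸ b) + q * b    ≡⟨ *-distribˡ-+ q (k ∸ b) b ⟨
  q * (k ∸ b + b)        ≡⟨ cong (q *_) (m∸n+n≡m b≤k) ⟩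
  q * k                  ∎)
  where open ≤-Reasoning

stretched⇒≤∣-∣* : ∀ p q k b .{{_ : NonZero q}} → (p + q) * k ≤ q * b → p * k ≤ ∣ b - k ∣ * q
stretched⇒≤∣-∣* p q k b stretched = +-cancelʳ-≤ (q * k) (p * k) (∣ b - k ∣ * q) (begin
  p * k + q * k          ≡⟨ *-distribʳ-+ k p q ⟨
  (p + q) * k            ≤⟨ stretched ⟩
  q * b                  ≡⟨ cong (q *_) (m∸n+n≡m k≤b) ⟨
  q * (b ∸ k + k)        ≡⟨ *-distribˡ-+ q (b ∸ k) k ⟩
  q * (b ∸ k) + q * k    ≡⟨ cong (_+ q * k) (*-comm q (b ∸ k)) ⟩
  (b ∸ k) * q + q * k    ≡⟨ cong (λ x → x * q + q * k) (m≤n⇒∣n-m∣≡n∸m k≤b) ⟨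
  ∣ b - k ∣ * q + q * k  ∎)
  where
  open ≤-Reasoning
  k≤b : k ≤ b
  k≤b = *-cancelˡ-≤ q (≤-trans (*-monoˡ-≤ k (m≤n+m q p)) stretched)

∣⊖∣≡∣-∣ : ∀ m n → ℤ.∣ m ⊖ n ∣ ≡ ∣ m - n ∣
∣⊖∣≡∣-∣ m n with ≤-total m n
... | inj₁ m≤n = trans (ℤ.∣⊖∣-≤ m≤n) (sym (m≤n⇒∣m-n∣≡n∸m m≤n))
... | inj₂ n≤m = trans (cong ℤ.∣_∣ (ℤ.⊖-≥ n≤m)) (sym (m≤n⇒∣n-m∣≡n∸m n≤m))

∣+m-+n∣≡∣m-n∣ : ∀ m n → ℤ.∣ + m ℤ.- + n ∣ ≡ ∣ m - n ∣
∣+m-+n∣≡∣m-n∣ m n = trans (cong ℤ.∣_∣ (ℤ.m-n≡m⊖n m n)) (∣⊖∣≡∣-∣ m n)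

toℚᵘ-∣frac-ℕ∣ : ∀ b d k →
  toℚᵘ (ℚ.∣ frac b (suc d) ℚ.- + k ℚ./ 1 ∣) ≃ᵘ mkℚᵘ (+ ∣ b - k * suc d ∣) d
toℚᵘ-∣frac-ℕ∣ b d k = begin
  toℚᵘ (ℚ.∣ x ℚ.- y ∣)
    ≈⟨ ℚ.toℚᵘ-homo-∣-∣ (x ℚ.- y) ⟩
  ℚᵘ.∣ toℚᵘ (x ℚ.- y) ∣
    ≈⟨ ℚᵘ.∣-∣-cong (ℚ.toℚᵘ-homo-+ x (ℚ.- y)) ⟩
  ℚᵘ.∣ toℚᵘ x ℚᵘ.+ toℚᵘ (ℚ.- y) ∣
    ≈⟨ ℚᵘ.∣-∣-cong (ℚᵘ.+-cong (ℚ.toℚᵘ-fromℚᵘ (mkℚᵘ (+ b) d))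
         (ℚᵘ.≃-trans (ℚ.toℚᵘ-homo‿- y) (ℚᵘ.-‿cong (ℚ.toℚᵘ-fromℚᵘ (mkℚᵘ (+ k) 0))))) ⟩
  ℚᵘ.∣ mkℚᵘ (+ b) d ℚᵘ.- mkℚᵘ (+ k) 0 ∣
    ≈⟨ *≡* (cong₂ (λ u v → + u ℤ.* + v) numerator (sym (*-identityʳ (suc d)))) ⟩
  mkℚᵘ (+ ∣ b - k * suc d ∣) d
    ∎
  where
  open ℚᵘ.≃-Reasoning
  x y : ℚ
  x = frac b (suc d)
  y = + k ℚ./ 1
  numerator : ℤ.∣ + b ℤ.* + 1 ℤ.+ ℤ.- (+ k) ℤ.* + suc d ∣ ≡ ∣ b - k * suc d ∣
  numerator = trans (cong₂ (λ u v → ℤ.∣ u ℤ.+ v ∣) (ℤ.*-identityʳ (+ b))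
                       (trans (sym (ℤ.neg-distribˡ-* (+ k) (+ suc d)))
                              (cong ℤ.-_ (sym (ℤ.pos-* k (suc d))))))
                    (∣+m-+n∣≡∣m-n∣ b (k * suc d))

module _ {x : ℚ} {b d : ℕ} (x≃ : toℚᵘ x ≃ᵘ mkℚᵘ (+ b) d) {P q : ℕ} .{c : Coprime P (suc q)} where

  <-mkℚ⇔ : x ℚ.< mkℚ (+ P) q c ⇔ b * suc q < P * suc d
  <-mkℚ⇔ = mk⇔
    (λ x<ε → ℤ.drop‿+<+ (subst₂ ℤ._<_ (sym (ℤ.pos-* b (suc q))) (sym (ℤ.pos-* P (suc d)))
               (ℚᵘ.drop-*<* (ℚᵘ.<-respˡ-≃ x≃ (ℚ.toℚᵘ-mono-< x<ε)))))
    (λ lt → ℚ.toℚᵘ-cancel-< (ℚᵘ.<-respˡ-≃ (ℚᵘ.≃-sym x≃)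
               (*<* (subst₂ ℤ._<_ (ℤ.pos-* b (suc q)) (ℤ.pos-* P (suc d)) (ℤ.+<+ lt)))))

  mkℚ-≤⇔ : mkℚ (+ P) q c ℚ.≤ x ⇔ P * suc d ≤ b * suc q
  mkℚ-≤⇔ = mk⇔
    (λ ε≤x → ℤ.drop‿+≤+ (subst₂ ℤ._≤_ (sym (ℤ.pos-* P (suc d))) (sym (ℤ.pos-* b (suc q)))
               (ℚᵘ.drop-*≤* (ℚᵘ.≤-respʳ-≃ x≃ (ℚ.toℚᵘ-mono-≤ ε≤x)))))
    (λ le → ℚ.toℚᵘ-cancel-≤ (ℚᵘ.≤-respʳ-≃ (ℚᵘ.≃-sym x≃)
               (*≤* (subst₂ ℤ._≤_ (ℤ.pos-* P (suc d)) (ℤ.pos-* b (suc q)) (ℤ.+≤+ le)))))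

toℚᵘ-∣frac-0∣ : ∀ b d → toℚᵘ (ℚ.∣ frac b (suc d) ℚ.- 0ℚ ∣) ≃ᵘ mkℚᵘ (+ b) d
toℚᵘ-∣frac-0∣ b d = subst (λ u → toℚᵘ (ℚ.∣ frac b (suc d) ℚ.- 0ℚ ∣) ≃ᵘ mkℚᵘ (+ u) d)
                           (m≤n⇒∣n-m∣≡n∸m {n = b} z≤n) (toℚᵘ-∣frac-ℕ∣ b d 0)

frac→0⇔negligible : ∀ a → ConvergesTo (λ n → frac (a n) n) 0ℚ ⇔ Negligible a
frac→0⇔negligible a = mk⇔ to from
  where
  to : ConvergesTo (λ n → frac (a n) n) 0ℚ → Negligible a
  to conv zero = 0 , λ _ 0<n → 0<n
  to conv (suc D) with conv (mkℚ (+ 1) D (1-coprimeTo (suc D))) _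
  ... | N , close = N , λ { (suc d) N<n → subst₂ _<_ (*-comm (a (suc d)) (suc D)) (*-identityˡ (suc d))
          (Equivalence.to (<-mkℚ⇔ (toℚᵘ-∣frac-0∣ (a (suc d)) d)) (close (suc d) (<⇒≤ N<n) (s≤s z≤n))) }
  from : Negligible a → ConvergesTo (λ n → frac (a n) n) 0ℚ
  from neg (mkℚ ℤ.+[1+ p ] q _) _ with neg (suc q)
  ... | N , small = suc N , λ { (suc d) N<n _ → Equivalence.from (<-mkℚ⇔ (toℚᵘ-∣frac-0∣ (a (suc d)) d))
          (<-≤-trans (≤-<-trans (≤-reflexive (*-comm (a (suc d)) (suc q))) (small (suc d) N<n))
                       (m≤n*m (suc d) (suc p))) }

mkℚ-≤∣frac-1∣⇔ : ∀ {P q} .{c : Coprime P (suc q)} b d →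
  mkℚ (+ P) q c ℚ.≤ ℚ.∣ frac b (suc d) ℚ.- 1ℚ ∣ ⇔ P * suc d ≤ ∣ b - suc d ∣ * suc q
mkℚ-≤∣frac-1∣⇔ b d = mkℚ-≤⇔ (subst (λ u → toℚᵘ (ℚ.∣ frac b (suc d) ℚ.- 1ℚ ∣) ≃ᵘ mkℚᵘ (+ ∣ b - u ∣) d)
                                   (*-identityˡ (suc d)) (toℚᵘ-∣frac-ℕ∣ b d 1))

escapes : (ℕ → ℕ) → ℕ → ℕ
escapes f n = count (λ k → n <? f k) n

escapes-≤ : ∀ f n → escapes f n ≤ n
escapes-≤ f n = count-≤ _ n

stretches shrinks : (p q : ℕ) → (ℕ → ℕ) → ℕ → ℕ
stretches p q f = count (λ k → (p + q) * k ≤? q * f k)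
shrinks p q f = count (λ k → (p + q) * f k ≤? q * k)

escapes-negligible : ∀ {f} → (∀ q → Negligible (stretches 1 (suc q) f)) → Negligible (escapes f)
escapes-negligible {f} neg-stretches E with neg-stretches (4 * E) (2 * E)
... | N , stretches-small = N , escapes-small
  where
  Q : ℕ
  Q = suc (4 * E)
  escapes-small : ∀ n → N < n → E * escapes f n < n
  escapes-small n N<n = *-cancelˡ-< 2 _ _ (begin-strict
    2 * (E * escapes f n)                              ≤⟨ *-monoʳ-≤ 2 (*-monoʳ-≤ E
                                                            (count-⊎ _ _ late? n stretched-or-late)) ⟩
    2 * (E * (stretches 1 Q f n + count late? n))      ≡⟨ distrib E (stretches 1 Q f n) (count late? n) ⟩
    2 * E * stretches 1 Q f n + 2 * E * count late? n  <⟨ +-mono-<-≤ (stretches-small n N<n) few-late ⟩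
    n + n                                              ≡⟨ double n ⟩
    2 * n                                              ∎)
    where
    open ≤-Reasoning
    distrib : ∀ E x y → 2 * (E * (x + y)) ≡ 2 * E * x + 2 * E * y
    distrib = solve-∀
    double : ∀ n → n + n ≡ 2 * n
    double = solve-∀
    quadruple : ∀ E x → 2 * (2 * E * x) ≡ 4 * E * x
    quadruple = solve-∀

    late? : Decidable (λ k → Q * suc n < suc Q * k)
    late? k = Q * suc n <? suc Q * k

    stretched-or-late : All≤ n (λ k → n < f k → suc Q * k ≤ Q * f k ⊎ Q * suc n < suc Q * k)
    stretched-or-late k _ _ n<fk with late? k
    ... | yes late = inj₂ late
    ... | no ¬late = inj₁ (≤-trans (≮⇒≥ ¬late) (*-monoʳ-≤ Q n<fk))

    few-late : 2 * E * count late? n ≤ n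
    few-late = *-cancelˡ-≤ 2 (begin
      2 * (2 * E * count late? n)  ≡⟨ quadruple E (count late? n) ⟩
      4 * E * count late? n        ≤⟨ *-monoˡ-≤ (count late? n) (≤-trans (n≤1+n (4 * E)) (n≤1+n Q)) ⟩
      suc Q * count late? n        ≤⟨ count-d<c*k (suc Q) (Q * suc n) n ⟩
      suc Q * suc n ∸ Q * suc n    ≡⟨ m+n∸n≡m (suc n) (Q * suc n) ⟩
      suc n                        ≡⟨ +-comm 1 n ⟩
      n + 1                        ≤⟨ +-monoʳ-≤ n (≤-trans (s≤s z≤n) N<n) ⟩
      n + n                        ≡⟨ double n ⟩
      2 * n                        ∎)

module _ (p q : ℕ) .{{_ : NonZero p}} {f : ℕ → ℕ} where

  stretches-negligible : Negligible (escapes f) → Negligible (stretches p q f)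
  stretches-negligible neg-e =
    negligible-by-descent p q {c = stretches p q f} (count-≤ _) (escapes-≤ f) neg-e
      (λ floor → _ , ≤-refl , step floor)
    where
    step : ∀ {n m} → IsFloorDiv (q * n) (p + q) m → stretches p q f n ≤ stretches p q f m + escapes f n
    step {n} {m} floor@(_ , qn<[p+q][1+m]) = begin
      stretches p q f n
        ≡⟨ count-split _ (ratio-floor-≤ p q floor) ⟩
      stretches p q f m + count (λ k → (m <? k) ×-dec ((p + q) * k ≤? q * f k)) n
        ≤⟨ +-monoʳ-≤ _ (count-mono _ _ n escaping) ⟩
      stretches p q f m + escapes f n
        ∎
      where
      open ≤-Reasoning
      escaping : All≤ n (λ k → m < k × (p + q) * k ≤ q * f k → n < f k)
      escaping k _ _ (m<k , stretched) = *-cancelˡ-< q _ _ (begin-strict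
        q * n            <⟨ qn<[p+q][1+m] ⟩
        (p + q) * suc m  ≤⟨ *-monoʳ-≤ (p + q) m<k ⟩
        (p + q) * k      ≤⟨ stretched ⟩
        q * f k          ∎)

module _ {f : ℕ → ℕ} (f-positive : ∀ {k} → 1 ≤ k → 1 ≤ f k)
         (f-injective : ∀ {i j} → 1 ≤ i → 1 ≤ j → f i ≡ f j → i ≡ j) where

  count-f≤m≤m : ∀ m M → count (λ k → f k ≤? m) M ≤ m
  count-f≤m≤m zero M = ≤-reflexive (count-zero _ M (λ k k≥1 _ fk≤0 → <⇒≱ (f-positive k≥1) fk≤0))
  count-f≤m≤m (suc m) M = begin
    count (λ k → f k ≤? suc m) M                            ≤⟨ count-⊎ _ _ _ M
                                                                 (λ k _ _ → map₁ ≤-pred ∘ m≤n⇒m<n∨m≡n) ⟩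
    count (λ k → f k ≤? m) M + count (λ k → f k ≟ suc m) M  ≤⟨ +-mono-≤ (count-f≤m≤m m M)
                                                                          (count-≤1 _ hit-once M) ⟩
    m + 1                                                   ≡⟨ +-comm m 1 ⟩
    suc m                                                   ∎
    where
    open ≤-Reasoning
    hit-once : ∀ {i j} → 1 ≤ i → 1 ≤ j → f i ≡ suc m → f j ≡ suc m → i ≡ j
    hit-once i≥1 j≥1 fi≡ fj≡ = f-injective i≥1 j≥1 (trans fi≡ (sym fj≡))

  -- Of the at most m indices k ≤ n with f k ≤ m, exactly m ∸ escapes f m lie in [1, m].
  count-returning≤escapes : ∀ {m n} → m ≤ n → count (λ k → (m <? k) ×-dec (f k ≤? m)) n ≤ escapes f m
  count-returning≤escapes {m} {n} m≤n = +-cancelˡ-≤ (count F? m) _ _ (begin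
    count F? m + count (λ k → (m <? k) ×-dec F? k) n  ≡⟨ count-split F? m≤n ⟨
    count F? n                                        ≤⟨ count-f≤m≤m m n ⟩
    m                                                 ≡⟨ count-complement F? (λ k → m <? f k)
                                                           (λ k → ≤-<-connex (f k) m) (λ k → flip <⇒≱) m ⟨
    count F? m + escapes f m                          ∎)
    where
    open ≤-Reasoning
    F? : Decidable (λ k → f k ≤ m)
    F? k = f k ≤? m

  module _ (p q : ℕ) .{{_ : NonZero p}} where

    shrinks-negligible : Negligible (escapes f) → Negligible (shrinks p q f)
    shrinks-negligible neg-e =
      negligible-by-descent p q {c = shrinks p q f} (count-≤ _) (escapes-≤ f) neg-e
        (λ floor → _ , ratio-floor-≤ p q floor , step floor)
      where
      step : ∀ {n m} → IsFloorDiv (q * n) (p + q) m → shrinks p q f n ≤ shrinks p q f m + escapes f m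
      step {n} {m} floor@(_ , qn<[p+q][1+m]) = begin
        shrinks p q f n
          ≡⟨ count-split _ m≤n ⟩
        shrinks p q f m + count (λ k → (m <? k) ×-dec ((p + q) * f k ≤? q * k)) n
          ≤⟨ +-monoʳ-≤ _ (count-mono _ _ n returning) ⟩
        shrinks p q f m + count (λ k → (m <? k) ×-dec (f k ≤? m)) n
          ≤⟨ +-monoʳ-≤ _ (count-returning≤escapes m≤n) ⟩
        shrinks p q f m + escapes f m
          ∎
        where
        open ≤-Reasoning
        m≤n : m ≤ n
        m≤n = ratio-floor-≤ p q floor
        returning : All≤ n (λ k → m < k × (p + q) * f k ≤ q * k → m < k × f k ≤ m)
        returning k _ k≤n (m<k , shrunk) = m<k , ≤-pred (*-cancelˡ-< (p + q) _ _ (begin-strict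
          (p + q) * f k    ≤⟨ shrunk ⟩
          q * k            ≤⟨ *-monoʳ-≤ q k≤n ⟩
          q * n            <⟨ qn<[p+q][1+m] ⟩
          (p + q) * suc m  ∎))

  escapes-negligible⇒statConvergesTo : Negligible (escapes f) → StatConvergesTo (λ n → frac (f n) n) 1ℚ
  escapes-negligible⇒statConvergesTo neg-e ε@(mkℚ +[1+ p ] q _) _ =
    Equivalence.from (frac→0⇔negligible _)
      (negligible-mono (λ n → count-⊎ _ _ _ n stretched⊎shrunk)
        (negligible-+ (stretches-negligible P Q neg-e) (shrinks-negligible P Q neg-e)))
    where
    P Q : ℕ
    P = suc p
    Q = suc q
    stretched⊎shrunk : ∀ {n} → All≤ n (λ k → ε ℚ.≤ ℚ.∣ frac (f k) k ℚ.- 1ℚ ∣ →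
                                         (P + Q) * k ≤ Q * f k ⊎ (P + Q) * f k ≤ Q * k)
    stretched⊎shrunk (suc d) _ _ far = ≤∣-∣*⇒stretched⊎shrunk P Q (suc d) (f (suc d))
      (Equivalence.to (mkℚ-≤∣frac-1∣⇔ (f (suc d)) d) far)

statConvergesTo⇒escapes-negligible : ∀ {f} →
  StatConvergesTo (λ n → frac (f n) n) 1ℚ → Negligible (escapes f)
statConvergesTo⇒escapes-negligible {f} stat = escapes-negligible λ q →
  negligible-mono (λ n → count-mono _ _ n (deviating q))
    (Equivalence.to (frac→0⇔negligible _) (stat (mkℚ (+ 1) q (1-coprimeTo (suc q))) _))
  where
  deviating : ∀ q {n} → All≤ n (λ k → (1 + suc q) * k ≤ suc q * f k →
                                  mkℚ (+ 1) q (1-coprimeTo (suc q)) ℚ.≤ ℚ.∣ frac (f k) k ℚ.- 1ℚ ∣)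
  deviating q (suc d) _ _ stretched = Equivalence.from (mkℚ-≤∣frac-1∣⇔ (f (suc d)) d)
    (stretched⇒≤∣-∣* 1 (suc q) (suc d) (f (suc d)) stretched)

ℕ⁺-≡ : {x y : ℕ⁺} → proj₁ x ≡ proj₁ y → x ≡ y
ℕ⁺-≡ {suc a , _} {suc .a , _} refl = refl

app-positive : ∀ π {k} → 1 ≤ k → 1 ≤ app π k
app-positive π {suc i} _ = >-nonZero⁻¹ _ {{proj₂ (Inverse.to π (suc i , _))}}

app-injective : ∀ π {i j} → 1 ≤ i → 1 ≤ j → app π i ≡ app π j → i ≡ j
app-injective π {suc i} {suc j} _ _ eq = cong proj₁ (Injection.injective (↔⇒↣ π) (ℕ⁺-≡ eq))

theorem2p2 : (π : Perm⁺) →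
    InLevyGroup π ⇔ StatConvergesTo (λ n → frac (app π n) n) 1ℚ
theorem2p2 π = mk⇔
  (escapes-negligible⇒statConvergesTo (app-positive π) (app-injective π) ∘ Equivalence.to levy⇔)
  (Equivalence.from levy⇔ ∘ statConvergesTo⇒escapes-negligible)
  where
  levy⇔ : InLevyGroup π ⇔ Negligible (escapes (app π))
  levy⇔ = frac→0⇔negligible (escapes (app π))
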